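{- Let $\mathcal{K}$ be a $d$-dimensional cubical complex with $d \geq 1$, and let $f_i(\mathcal{K})$ denote the number of $i$-dimensional faces of $\mathcal{K}$. Then $$\sum_{i=0}^d 2^i f_i(\mathcal{K}) \leq \left(f_0(\mathcal{K})\right)^2.$$
   Context: A cubical complex $\mathcal{K}$ on a finite vertex set $V$ is a collection of subsets of $V$, partially ordered by inclusion, such that: $\emptyset\in\mathcal{K}$; $\{v\}\in\mathcal{K}$ for every $v\in V$; for every nonempty $F\in\mathcal{K}$ the interval $[\emptyset,F]=\{G\in\mathcal{K}:G\subseteq F\}$ is isomorphic to the face poset of a cube of some dimension $k$ (then $F$ is a $k$-dimensional face, $\dim F=k$); and $F\cap G\in\mathcal{K}$ whenever $F,G\in\mathcal{K}$. The dimension of $\mathcal{K}$ is the maximum dimension of its faces. -}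

module Defs where

open import Data.Nat using (ℕ; zero; suc; _+_; _*_; _^_; _≤_; _≡ᵇ_)
open import Data.Bool using (Bool; true; false; _∧_; not)
open import Data.Fin using (Fin)
open import Data.Fin.Subset using (Subset; _⊆_; _∩_; ⁅_⁆; ⊥; ∣_∣; Nonempty)
open import Data.Vec using (Vec; []; _∷_; lookup)
open import Data.Maybe using (Maybe; just; nothing)
open import Data.List using (List; []; _∷_; map; _++_; length; filter; upTo)
open import Data.Nat.ListAction using (sum)
open import Data.Product using (Σ; _×_; _,_; proj₁; ∃)
open import Data.Sum using (_⊎_)
open import Data.Bool.Properties using (T?)
open import Data.Unit using (⊤)
open import Data.Empty using () renaming (⊥ to Empty)
open import Relation.Binary.PropositionalEquality using (_≡_)
open import Data.Fin.Properties using ()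
open import Data.Bool using (T)

-- Face poset of the k-dimensional cube [0,1]^k, INCLUDING the empty face.
-- A nonempty face is a word in {0,1,*}^k; the empty face is `nothing`.

data Sym : Set where
  s0 s1 star : Sym

CubeFace : ℕ → Set
CubeFace k = Maybe (Vec Sym k)

_≤c_ : ∀ {k} → CubeFace k → CubeFace k → Set
nothing ≤c _ = ⊤
just _ ≤c nothing = Empty
just x ≤c just y = ∀ i → (lookup x i ≡ lookup y i) ⊎ (lookup y i ≡ star)

Family : ℕ → Set
Family n = Subset n → Bool

_∈K_ : ∀ {n} → Subset n → Family n → Set
F ∈K K = K F ≡ true

Interval : ∀ {n} → Family n → Subset n → Set
Interval K F = Σ (Subset _) λ G → (G ∈K K) × (G ⊆ F)

record IntervalIsCube {n} (K : Family n) (F : Subset n) (k : ℕ) : Set where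
  field
    to      : Interval K F → CubeFace k
    from    : CubeFace k → Interval K F
    from-to : ∀ G → proj₁ (from (to G)) ≡ proj₁ G
    to-from : ∀ c → to (from c) ≡ c
    mono    : ∀ G H → proj₁ G ⊆ proj₁ H → to G ≤c to H
    reflect : ∀ G H → to G ≤c to H → proj₁ G ⊆ proj₁ H

record IsCubicalComplex {n} (K : Family n) : Set where
  field
    empty∈    : ⊥ ∈K K
    vertex∈   : ∀ (v : Fin n) → ⁅ v ⁆ ∈K K
    interval  : ∀ F → F ∈K K → Nonempty F → ∃ λ k → IntervalIsCube K F k
    ∩-closed  : ∀ F G → F ∈K K → G ∈K K → (F ∩ G) ∈K K

-- A dimension function: assigns to every nonempty face F of K a k such
-- that [∅,F] is isomorphic to the face poset of the k-cube.
-- (Such k is unique, since the k-cube face poset has 3^k + 1 elements.)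

IsDimFunction : ∀ {n} → Family n → (Subset n → ℕ) → Set
IsDimFunction K dim = ∀ F → F ∈K K → Nonempty F → IntervalIsCube K F (dim F)

subsets : (n : ℕ) → List (Subset n)
subsets zero = [] ∷ []
subsets (suc n) = map (true ∷_) (subsets n) ++ map (false ∷_) (subsets n)

nonemptyᵇ : ∀ {n} → Subset n → Bool
nonemptyᵇ F = not (∣ F ∣ ≡ᵇ 0)

fvec : ∀ {n} → Family n → (Subset n → ℕ) → ℕ → ℕ
fvec {n} K dim i =
  length (filter (λ F → T? (K F ∧ nonemptyᵇ F ∧ (dim F ≡ᵇ i))) (subsets n))

HasDimension : ∀ {n} → Family n → (Subset n → ℕ) → ℕ → Set
HasDimension K dim d =
  (∃ λ F → (F ∈K K) × Nonempty F × (dim F ≡ d)) ×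
  (∀ F → F ∈K K → Nonempty F → dim F ≤ d)

weightedSum : ∀ {n} → Family n → (Subset n → ℕ) → ℕ → ℕ
weightedSum K dim d = sum (map (λ i → 2 ^ i * fvec K dim i) (upTo (suc d)))

module Submission where

-- A nonempty face F of dimension k has an interval isomorphic to the face poset of the
-- k-cube, so each of the 2^k cube vertices c determines a vertex of K in F, injectively.
-- Pairing the vertex at c with the one at the antipodal vertex gives 2^k ordered pairs of
-- vertices of K, and F is the smallest face containing such a pair: its intersection with
-- any face containing both lies above two antipodal cube vertices, hence is all of F. So
-- pairs coming from different faces are distinct, and Σ_F 2^(dim F) ≤ n² ≤ f₀², where n is
-- the number of vertices (every singleton is a 0-face).

open import Defs
open import Data.Nat using (ℕ; zero; suc; _+_; _*_; _^_; _≤_; _≡ᵇ_; z≤n; s≤s)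
open import Data.Nat.Properties
  using (≤-trans; ≤-reflexive; +-mono-≤; *-mono-≤; *-zeroʳ; *-identityʳ; +-identityʳ;
         *-distribˡ-+; ≡ᵇ⇒≡; +-commutativeSemigroup; module ≤-Reasoning)
open import Algebra.Properties.CommutativeSemigroup +-commutativeSemigroup using (interchange)
open import Data.Bool using (Bool; true; false; _∧_; not; T)
open import Data.Bool.Properties using (T?; T-∧; T-≡)
import Data.Bool as Bool
open import Data.Fin using (Fin)
open import Data.Fin.Subset using (Subset; _⊆_; _∩_; ⁅_⁆; ⊥; ∁; Nonempty; _∈_)
open import Data.Fin.Subset.Properties
  using (Empty-unique; nonempty?; ∉⊥; x∈⁅x⁆; x∈⁅y⁆⇒x≡y; ⊆-antisym; p∩q⊆p; x∈p∩q⁺; x∈p∩q⁻;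
         ∣⊥∣≡0; ∣⁅x⁆∣≡1)
open import Data.Vec using (Vec; []; _∷_; lookup; replicate)
import Data.Vec as Vec
open import Data.Vec.Properties using (∷-injective; ∷-injectiveʳ; lookup-map; lookup-replicate; tabulate∘lookup; tabulate-cong)
open import Data.Maybe using (just; nothing)
open import Data.Maybe.Properties using (just-injective)
open import Data.Unit using (tt)
open import Data.List using (List; []; _∷_; [_]; _++_; length; filter; map; concatMap; upTo; allFin;
                             cartesianProduct)
open import Data.List.Properties using (length-map; length-++; length-tabulate; filter-++;
                                        filter-accept; filter-reject)
open import Data.Nat.ListAction using (sum)
import Data.List.Membership.Propositional as List
open import Data.List.Membership.Propositional.Properties
  using (∈-map⁺; ∈-map⁻; ∈-++⁺ˡ; ∈-++⁺ʳ; ∈-filter⁺; ∈-allFin; ∈-cartesianProduct⁺)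
open import Data.List.Relation.Unary.Any using (here; there)
open import Data.List.Relation.Unary.All as All using (All; []; _∷_)
import Data.List.Relation.Unary.All.Properties as All
open import Data.List.Relation.Unary.AllPairs as AllPairs using ([]; _∷_)
import Data.List.Relation.Unary.AllPairs.Properties as AllPairs
open import Data.List.Relation.Unary.Unique.Propositional using (Unique)
open import Data.List.Relation.Unary.Unique.Propositional.Properties as Unique
  using (allFin⁺; concat⁺; ++⁺)
open import Data.Product using (∃₂; _×_; _,_; proj₁; proj₂)
open import Data.Sum using (_⊎_; inj₁; inj₂)
open import Data.Empty using (⊥-elim)
open import Function using (_∘_; Equivalence)
open import Relation.Nullary using (¬_; Dec; yes; no; contradiction)
open import Relation.Nullary.Decidable using (_×-dec_)
open import Relation.Binary.PropositionalEquality
  using (_≡_; _≢_; refl; sym; trans; cong; cong₂; subst; subst₂; module ≡-Reasoning)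

module _ {A : Set} where

  remove : ∀ {x : A} (xs : List A) → x List.∈ xs → List A
  remove (_ ∷ xs) (here _)  = xs
  remove (y ∷ xs) (there p) = y ∷ remove xs p

  length-remove : ∀ {x : A} (xs : List A) (p : x List.∈ xs) → length xs ≡ suc (length (remove xs p))
  length-remove (_ ∷ xs) (here _)  = refl
  length-remove (_ ∷ xs) (there p) = cong suc (length-remove xs p)

  ∈-remove : ∀ {x z : A} (xs : List A) (p : x List.∈ xs) → z List.∈ xs → z ≢ x → z List.∈ remove xs p
  ∈-remove (_ ∷ xs) (here refl) (here refl) z≢x = contradiction refl z≢x
  ∈-remove (_ ∷ xs) (here _)    (there q)   _   = q
  ∈-remove (_ ∷ xs) (there p)   (here z≡y)  _   = here z≡y
  ∈-remove (_ ∷ xs) (there p)   (there q)   z≢x = there (∈-remove xs p q z≢x)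

  Unique⇒length≤ : ∀ {xs ys : List A} → Unique xs → (∀ {z} → z List.∈ xs → z List.∈ ys) →
                   length xs ≤ length ys
  Unique⇒length≤ {[]}     _           _    = z≤n
  Unique⇒length≤ {x ∷ xs} {ys} (x∉xs ∷ xs!) xs⊆ys = begin
    suc (length xs)                         ≤⟨ s≤s (Unique⇒length≤ xs! xs⊆ys−x) ⟩
    suc (length (remove ys (xs⊆ys (here refl)))) ≡⟨ length-remove ys _ ⟨
    length ys                               ∎
    where
    open ≤-Reasoning
    xs⊆ys−x : ∀ {z} → z List.∈ xs → z List.∈ remove ys (xs⊆ys (here refl))
    xs⊆ys−x z∈xs = ∈-remove ys _ (xs⊆ys (there z∈xs)) (λ z≡x → All.lookup x∉xs z∈xs (sym z≡x))

module _ {A B : Set} (f : A → List B) where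

  concatMap⁺ : (∀ x → Unique (f x)) → (∀ {x y z} → z List.∈ f x → z List.∈ f y → x ≡ y) →
               ∀ {xs} → Unique xs → Unique (concatMap f xs)
  concatMap⁺ f! disjoint {xs} xs! = concat⁺ (All.map⁺ (All.universal f! xs))
    (AllPairs.map⁺ (AllPairs.map (λ x≢y {_} (z∈fx , z∈fy) → x≢y (disjoint z∈fx z∈fy)) xs!))

length-cartesianProduct : ∀ {A B : Set} (xs : List A) (ys : List B) →
                          length (cartesianProduct xs ys) ≡ length xs * length ys
length-cartesianProduct []       ys = refl
length-cartesianProduct (x ∷ xs) ys = begin
  length (map (x ,_) ys ++ cartesianProduct xs ys)  ≡⟨ length-++ (map (x ,_) ys) ⟩
  length (map (x ,_) ys) + length (cartesianProduct xs ys)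
    ≡⟨ cong₂ _+_ (length-map (x ,_) ys) (length-cartesianProduct xs ys) ⟩
  length ys + length xs * length ys                 ∎
  where open ≡-Reasoning

module _ {A : Set} (c : ℕ → ℕ) (P : ℕ → A → Bool) where

  weightedCount : List ℕ → List A → ℕ
  weightedCount I xs = sum (map (λ i → c i * length (filter (T? ∘ P i) xs)) I)

  weightedCount-[] : ∀ I → weightedCount I [] ≡ 0
  weightedCount-[] []      = refl
  weightedCount-[] (i ∷ I) = cong₂ _+_ (*-zeroʳ (c i)) (weightedCount-[] I)

  weightedCount-++ : ∀ I xs ys → weightedCount I (xs ++ ys) ≡ weightedCount I xs + weightedCount I ys
  weightedCount-++ []      xs ys = refl
  weightedCount-++ (i ∷ I) xs ys = begin
    c i * length (filter (T? ∘ P i) (xs ++ ys)) + weightedCount I (xs ++ ys)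
      ≡⟨ cong₂ _+_ (cong (c i *_) count-++) (weightedCount-++ I xs ys) ⟩
    c i * (count xs + count ys) + (weightedCount I xs + weightedCount I ys)
      ≡⟨ cong (_+ (weightedCount I xs + weightedCount I ys)) (*-distribˡ-+ (c i) (count xs) (count ys)) ⟩
    (c i * count xs + c i * count ys) + (weightedCount I xs + weightedCount I ys)
      ≡⟨ interchange (c i * count xs) (c i * count ys) _ _ ⟩
    (c i * count xs + weightedCount I xs) + (c i * count ys + weightedCount I ys) ∎
    where
    open ≡-Reasoning
    count : List A → ℕ
    count zs = length (filter (T? ∘ P i) zs)
    count-++ : count (xs ++ ys) ≡ count xs + count ys
    count-++ = trans (cong length (filter-++ (T? ∘ P i) xs ys)) (length-++ (filter (T? ∘ P i) xs))

  weightedCount-[x]≡0 : ∀ {x I} → All (λ i → ¬ T (P i x)) I → weightedCount I [ x ] ≡ 0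
  weightedCount-[x]≡0 []           = refl
  weightedCount-[x]≡0 {x} {i ∷ I} (¬Pix ∷ ¬PIx) = cong₂ _+_
    (trans (cong (λ zs → c i * length zs) (filter-reject (T? ∘ P i) ¬Pix)) (*-zeroʳ (c i)))
    (weightedCount-[x]≡0 ¬PIx)

  weightedCount-[x]≤ : ∀ {x m I} → Unique I → (∀ i → T (P i x) → i ≡ m) → weightedCount I [ x ] ≤ c m
  weightedCount-[x]≤ {I = []}    _             _     = z≤n
  weightedCount-[x]≤ {x} {m} {i ∷ I} (i∉I ∷ I!) Px⇒≡m with T? (P i x)
  ... | yes Pix rewrite filter-accept (T? ∘ P i) {xs = []} Pix | Px⇒≡m i Pix = ≤-reflexive (begin
    c m * 1 + weightedCount I [ x ] ≡⟨ cong₂ _+_ (*-identityʳ (c m)) (weightedCount-[x]≡0 ¬PIx) ⟩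
    c m + 0                         ≡⟨ +-identityʳ (c m) ⟩
    c m                             ∎)
    where
    open ≡-Reasoning
    ¬PIx : All (λ j → ¬ T (P j x)) I
    ¬PIx = All.map (λ m≢j Pjx → m≢j (sym (Px⇒≡m _ Pjx))) i∉I
  ... | no ¬Pix rewrite filter-reject (T? ∘ P i) {xs = []} ¬Pix | *-zeroʳ (c i) =
    weightedCount-[x]≤ I! Px⇒≡m

  weightedCount≤length-concatMap : ∀ {B : Set} {I} (g : A → List B) →
    (∀ x → weightedCount I [ x ] ≤ length (g x)) → ∀ xs → weightedCount I xs ≤ length (concatMap g xs)
  weightedCount≤length-concatMap {I = I} g bound []       = ≤-reflexive (weightedCount-[] I)
  weightedCount≤length-concatMap {I = I} g bound (x ∷ xs) = begin
    weightedCount I ([ x ] ++ xs)                ≡⟨ weightedCount-++ I [ x ] xs ⟩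
    weightedCount I [ x ] + weightedCount I xs   ≤⟨ +-mono-≤ (bound x) (weightedCount≤length-concatMap {I = I} g bound xs) ⟩
    length (g x) + length (concatMap g xs)       ≡⟨ length-++ (g x) {concatMap g xs} ⟨
    length (concatMap g (x ∷ xs))                ∎
    where open ≤-Reasoning

length-allFin : ∀ n → length (allFin n) ≡ n
length-allFin n = length-tabulate (λ i → i)

length-subsets : ∀ k → length (subsets k) ≡ 2 ^ k
length-subsets zero    = refl
length-subsets (suc k) = begin
  length (map (true ∷_) (subsets k) ++ map (false ∷_) (subsets k))
    ≡⟨ length-++ (map (true ∷_) (subsets k)) ⟩
  length (map (true ∷_) (subsets k)) + length (map (false ∷_) (subsets k))
    ≡⟨ cong₂ _+_ (length-map (true ∷_) (subsets k)) (length-map (false ∷_) (subsets k)) ⟩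
  length (subsets k) + length (subsets k)
    ≡⟨ cong₂ _+_ (length-subsets k) (trans (length-subsets k) (sym (+-identityʳ (2 ^ k)))) ⟩
  2 ^ k + (2 ^ k + 0) ∎
  where open ≡-Reasoning

subsets⁺ : ∀ k → Unique (subsets k)
subsets⁺ zero    = [] ∷ []
subsets⁺ (suc k) = ++⁺ (Unique.map⁺ ∷-injectiveʳ (subsets⁺ k)) (Unique.map⁺ ∷-injectiveʳ (subsets⁺ k))
  λ (p , q) → true≢false (trans (sym (head-of {true} p)) (head-of {false} q))
  where
  head-of : ∀ {b} {x : Subset (suc k)} → x List.∈ map (b ∷_) (subsets k) → Vec.head x ≡ b
  head-of x∈ with ∈-map⁻ _ x∈
  ... | _ , _ , refl = refl
  true≢false : true ≢ false
  true≢false ()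

∈-subsets : ∀ {k} (x : Subset k) → x List.∈ subsets k
∈-subsets []              = here refl
∈-subsets (true ∷ x)      = ∈-++⁺ˡ (∈-map⁺ (true ∷_) (∈-subsets x))
∈-subsets {suc k} (false ∷ x) = ∈-++⁺ʳ (map (true ∷_) (subsets k)) (∈-map⁺ (false ∷_) (∈-subsets x))

symbol : Bool → Sym
symbol false = s0
symbol true  = s1

-- A vertex of the k-cube is a bit vector; ∁ c is the vertex antipodal to c.
vertex : ∀ {k} → Subset k → CubeFace k
vertex c = just (Vec.map symbol c)

top : ∀ k → CubeFace k
top k = just (replicate k star)

_⊑_ : Sym → Sym → Set
a ⊑ b = a ≡ b ⊎ b ≡ star

⊑-antisym : ∀ {a b} → a ⊑ b → b ⊑ a → a ≡ b
⊑-antisym (inj₁ a≡b) _            = a≡b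
⊑-antisym (inj₂ _)   (inj₁ b≡a)   = sym b≡a
⊑-antisym (inj₂ b≡★) (inj₂ a≡★)   = trans a≡★ (sym b≡★)

⊑-symbol : ∀ {a} x → a ⊑ symbol x → a ≡ symbol x
⊑-symbol _     (inj₁ a≡x) = a≡x
⊑-symbol false (inj₂ ())
⊑-symbol true  (inj₂ ())

star-⊑ : ∀ {a} → star ⊑ a → a ≡ star
star-⊑ (inj₁ ★≡a) = sym ★≡a
star-⊑ (inj₂ a≡★) = a≡★

symbol-not-⊑ : ∀ {a} x → symbol x ⊑ a → symbol (not x) ⊑ a → a ≡ star
symbol-not-⊑ _     (inj₂ a≡★)  _           = a≡★
symbol-not-⊑ _     (inj₁ _)    (inj₂ a≡★)  = a≡★
symbol-not-⊑ false (inj₁ refl) (inj₁ ())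
symbol-not-⊑ true  (inj₁ refl) (inj₁ ())

lookup-ext : ∀ {A : Set} {k} {x y : Vec A k} → (∀ i → lookup x i ≡ lookup y i) → x ≡ y
lookup-ext {x = x} {y} x≗y = trans (sym (tabulate∘lookup x)) (trans (tabulate-cong x≗y) (tabulate∘lookup y))

lookup-vertex : ∀ {k} (c : Subset k) i → lookup (Vec.map symbol c) i ≡ symbol (lookup c i)
lookup-vertex c i = lookup-map i symbol c

≤c-antisym : ∀ {k} {a b : CubeFace k} → a ≤c b → b ≤c a → a ≡ b
≤c-antisym {a = nothing} {nothing} _   _   = refl
≤c-antisym {a = just x}  {just y}  x≤y y≤x = cong just (lookup-ext λ i → ⊑-antisym (x≤y i) (y≤x i))

≤c-refl : ∀ {k} (a : CubeFace k) → a ≤c a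
≤c-refl nothing  = tt
≤c-refl (just x) = λ _ → inj₁ refl

≤c-nothing : ∀ {k} {a : CubeFace k} → a ≤c nothing → a ≡ nothing
≤c-nothing {a = nothing} _ = refl

≤c-vertex : ∀ {k} {a : CubeFace k} (c : Subset k) → a ≤c vertex c → a ≡ nothing ⊎ a ≡ vertex c
≤c-vertex {a = nothing} c _   = inj₁ refl
≤c-vertex {a = just x}  c x≤c = inj₂ (cong just (lookup-ext λ i →
  trans (⊑-symbol (lookup c i) (subst (lookup x i ⊑_) (lookup-vertex c i) (x≤c i)))
        (sym (lookup-vertex c i))))

top-≤c : ∀ {k} {a : CubeFace k} → top k ≤c a → a ≡ top k
top-≤c {k} {just y} top≤y = cong just (lookup-ext λ i →
  trans (star-⊑ (subst (_⊑ lookup y i) (lookup-replicate i star) (top≤y i))) (sym (lookup-replicate i star)))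

vertex-∁-≤c : ∀ {k} {a : CubeFace k} (c : Subset k) → vertex c ≤c a → vertex (∁ c) ≤c a → a ≡ top k
vertex-∁-≤c {k} {just y} c c≤y ∁c≤y = cong just (lookup-ext λ i →
  trans (symbol-not-⊑ (lookup c i) (subst (_⊑ lookup y i) (lookup-vertex c i) (c≤y i))
          (subst (_⊑ lookup y i) (trans (lookup-vertex (∁ c) i) (cong symbol (lookup-map i not c))) (∁c≤y i)))
        (sym (lookup-replicate i star)))

symbol-injective : ∀ {x y} → symbol x ≡ symbol y → x ≡ y
symbol-injective {false} {false} _ = refl
symbol-injective {true}  {true}  _ = refl

vertex-injective : ∀ {k} {c c′ : Subset k} → vertex c ≡ vertex c′ → c ≡ c′
vertex-injective {c = []}    {[]}      _  = refl
vertex-injective {c = x ∷ c} {y ∷ c′} eq with ∷-injective (just-injective eq)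
... | x≡y , c≡c′ = cong₂ _∷_ (symbol-injective x≡y) (vertex-injective (cong just c≡c′))

vertex≢top : ∀ {k} (c : Subset (suc k)) → vertex c ≢ top (suc k)
vertex≢top (false ∷ _) ()
vertex≢top (true ∷ _)  ()

x∈p⇒⁅x⁆⊆p : ∀ {n} {x : Fin n} {p} → x ∈ p → ⁅ x ⁆ ⊆ p
x∈p⇒⁅x⁆⊆p {x = x} {p} x∈p y∈⁅x⁆ = subst (_∈ p) (sym (x∈⁅y⁆⇒x≡y x y∈⁅x⁆)) x∈p

module CubicalFace {n} {K : Family n} (K-cubical : IsCubicalComplex K)
                   {F : Subset n} (F∈K : F ∈K K) {k} (R : IntervalIsCube K F k) where
  open IsCubicalComplex K-cubical
  open IntervalIsCube R

  to-cong : ∀ G H → proj₁ G ≡ proj₁ H → to G ≡ to H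
  to-cong G H G≡H = ≤c-antisym (mono G H (subst (_ ∈_) G≡H)) (mono H G (subst (_ ∈_) (sym G≡H)))

  bottom : Interval K F
  bottom = ⊥ , empty∈ , λ x∈⊥ → contradiction x∈⊥ ∉⊥

  to-bottom : to bottom ≡ nothing
  to-bottom = ≤c-nothing (subst (to bottom ≤c_) (to-from nothing)
    (mono bottom (from nothing) (λ x∈⊥ → contradiction x∈⊥ ∉⊥)))

  whole : Interval K F
  whole = F , F∈K , λ x∈F → x∈F

  to-whole : to whole ≡ top k
  to-whole = top-≤c (subst (_≤c to whole) (to-from (top k))
    (mono (from (top k)) whole (proj₂ (proj₂ (from (top k))))))

  point : ∀ {v} → v ∈ F → Interval K F
  point {v} v∈F = ⁅ v ⁆ , vertex∈ v , x∈p⇒⁅x⁆⊆p v∈F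

  to-point≢nothing : ∀ {v} (v∈F : v ∈ F) → to (point v∈F) ≢ nothing
  to-point≢nothing {v} v∈F to≡nothing = ∉⊥ (reflect (point v∈F) bottom
    (subst₂ _≤c_ (sym to≡nothing) (sym to-bottom) tt) (x∈⁅x⁆ v))

  cornerFace-nonempty : ∀ c → Nonempty (proj₁ (from (vertex c)))
  cornerFace-nonempty c with nonempty? (proj₁ (from (vertex c)))
  ... | yes ne  = ne
  ... | no  ¬ne = ⊥-elim (just≢nothing (begin
    vertex c                ≡⟨ to-from (vertex c) ⟨
    to (from (vertex c))    ≡⟨ to-cong (from (vertex c)) bottom (Empty-unique ¬ne) ⟩
    to bottom               ≡⟨ to-bottom ⟩
    nothing                 ∎))
    where
    open ≡-Reasoning
    just≢nothing : vertex c ≢ nothing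
    just≢nothing ()

  corner : Subset k → Fin n
  corner c = proj₁ (cornerFace-nonempty c)

  corner∈F : ∀ c → corner c ∈ F
  corner∈F c = proj₂ (proj₂ (from (vertex c))) (proj₂ (cornerFace-nonempty c))

  to-corner : ∀ c → to (point (corner∈F c)) ≡ vertex c
  to-corner c with ≤c-vertex c (subst (to (point (corner∈F c)) ≤c_) (to-from (vertex c))
                   (mono (point (corner∈F c)) (from (vertex c)) (x∈p⇒⁅x⁆⊆p (proj₂ (cornerFace-nonempty c)))))
  ... | inj₁ to≡nothing = contradiction to≡nothing (to-point≢nothing (corner∈F c))
  ... | inj₂ to≡vertex  = to≡vertex

  corner-injective : ∀ {c c′} → corner c ≡ corner c′ → c ≡ c′
  corner-injective {c} {c′} eq = vertex-injective (begin
    vertex c                      ≡⟨ to-corner c ⟨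
    to (point (corner∈F c))       ≡⟨ to-cong (point (corner∈F c)) (point (corner∈F c′)) (cong ⁅_⁆ eq) ⟩
    to (point (corner∈F c′))      ≡⟨ to-corner c′ ⟩
    vertex c′                     ∎)
    where open ≡-Reasoning

  -- F ∩ H lies above two antipodal vertices of the cube, so it is the whole cube.
  antipodal-corners-span : ∀ c {H} → H ∈K K → corner c ∈ H → corner (∁ c) ∈ H → F ⊆ H
  antipodal-corners-span c {H} H∈K c∈H ∁c∈H x∈F =
    proj₂ (x∈p∩q⁻ F H (reflect whole F∩H whole≤F∩H x∈F))
    where
    F∩H : Interval K F
    F∩H = F ∩ H , ∩-closed F H F∈K H∈K , p∩q⊆p F H
    corner≤F∩H : ∀ c′ → corner c′ ∈ H → vertex c′ ≤c to F∩H
    corner≤F∩H c′ c′∈H = subst (_≤c to F∩H) (to-corner c′)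
      (mono (point (corner∈F c′)) F∩H (x∈p⇒⁅x⁆⊆p (x∈p∩q⁺ (corner∈F c′ , c′∈H))))
    whole≤F∩H : to whole ≤c to F∩H
    whole≤F∩H = subst₂ _≤c_ (sym to-whole)
      (sym (vertex-∁-≤c c (corner≤F∩H c c∈H) (corner≤F∩H (∁ c) ∁c∈H))) (≤c-refl (top k))

singleton-dim≡0 : ∀ {n} {K : Family n} → IsCubicalComplex K →
                  ∀ v {k} → IntervalIsCube K ⁅ v ⁆ k → k ≡ 0
singleton-dim≡0 K-cubical v {zero}  R = refl
singleton-dim≡0 K-cubical v {suc k} R = contradiction (begin
  vertex c                  ≡⟨ to-corner c ⟨
  to (point (corner∈F c))   ≡⟨ to-cong (point (corner∈F c)) whole (cong ⁅_⁆ (x∈⁅y⁆⇒x≡y v (corner∈F c))) ⟩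
  to whole                  ≡⟨ to-whole ⟩
  top (suc k)               ∎) (vertex≢top c)
  where
  open IsCubicalComplex K-cubical
  open IntervalIsCube R using (to)
  open CubicalFace K-cubical (vertex∈ v) R
  open ≡-Reasoning
  c : Subset (suc k)
  c = replicate (suc k) false

nonemptyᵇ-sound : ∀ {n} {F : Subset n} → T (nonemptyᵇ F) → Nonempty F
nonemptyᵇ-sound {n} {F} F≢∅ with nonempty? F
... | yes ne  = ne
... | no  ¬ne = ⊥-elim (subst (λ m → T (not (m ≡ᵇ 0))) (∣⊥∣≡0 n) (subst (T ∘ nonemptyᵇ) (Empty-unique ¬ne) F≢∅))

⁅⁆-injective : ∀ {n} {x y : Fin n} → ⁅ x ⁆ ≡ ⁅ y ⁆ → x ≡ y
⁅⁆-injective {x = x} {y} eq = x∈⁅y⁆⇒x≡y y (subst (x ∈_) eq (x∈⁅x⁆ x))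

module _ {n} {K : Family n} (K-cubical : IsCubicalComplex K)
         {dim : Subset n → ℕ} (isDim : IsDimFunction K dim) where

  open IsCubicalComplex K-cubical

  IsFace : Subset n → Set
  IsFace F = F ∈K K × Nonempty F

  isFace? : ∀ F → Dec (IsFace F)
  isFace? F = (K F Bool.≟ true) ×-dec nonempty? F

  module Face {F} (F-face : IsFace F) =
    CubicalFace K-cubical (proj₁ F-face) (isDim F (proj₁ F-face) (proj₂ F-face))

  antipodalPair : ∀ {F} → IsFace F → Subset (dim F) → Fin n × Fin n
  antipodalPair F-face c = corner c , corner (∁ c)
    where open Face F-face

  antipodalPairs : Subset n → List (Fin n × Fin n)
  antipodalPairs F with isFace? F
  ... | yes F-face = map (antipodalPair F-face) (subsets (dim F))
  ... | no  _      = []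

  antipodalPairs⁺ : ∀ F → Unique (antipodalPairs F)
  antipodalPairs⁺ F with isFace? F
  ... | yes F-face = Unique.map⁺ (λ eq → Face.corner-injective F-face (cong proj₁ eq)) (subsets⁺ (dim F))
  ... | no  _      = []

  ∈-antipodalPairs⁻ : ∀ {F z} → z List.∈ antipodalPairs F →
                      ∃₂ λ (F-face : IsFace F) c → z ≡ antipodalPair F-face c
  ∈-antipodalPairs⁻ {F} z∈ with isFace? F
  ... | yes F-face = let c , _ , z≡ = ∈-map⁻ (antipodalPair F-face) z∈ in F-face , c , z≡

  antipodalPair≡⇒⊆ : ∀ {F G} (F-face : IsFace F) (G-face : IsFace G) c c′ →
                     antipodalPair F-face c ≡ antipodalPair G-face c′ → F ⊆ G
  antipodalPair≡⇒⊆ {G = G} F-face G-face c c′ eq = Face.antipodal-corners-span F-face c (proj₁ G-face)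
    (subst (_∈ G) (sym (cong proj₁ eq)) (Face.corner∈F G-face c′))
    (subst (_∈ G) (sym (cong proj₂ eq)) (Face.corner∈F G-face (∁ c′)))

  antipodalPairs-disjoint : ∀ {F G z} → z List.∈ antipodalPairs F → z List.∈ antipodalPairs G → F ≡ G
  antipodalPairs-disjoint z∈F z∈G with ∈-antipodalPairs⁻ z∈F | ∈-antipodalPairs⁻ z∈G
  ... | F-face , c , z≡Fc | G-face , c′ , z≡Gc′ = ⊆-antisym
    (antipodalPair≡⇒⊆ F-face G-face c c′ (trans (sym z≡Fc) z≡Gc′))
    (antipodalPair≡⇒⊆ G-face F-face c′ c (trans (sym z≡Gc′) z≡Fc))

  length-antipodalPairs≤n² : length (concatMap antipodalPairs (subsets n)) ≤ n * n
  length-antipodalPairs≤n² = begin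
    length (concatMap antipodalPairs (subsets n))
      ≤⟨ Unique⇒length≤ (concatMap⁺ antipodalPairs antipodalPairs⁺ antipodalPairs-disjoint (subsets⁺ n))
                        (λ {(u , v)} _ → ∈-cartesianProduct⁺ (∈-allFin u) (∈-allFin v)) ⟩
    length (cartesianProduct (allFin n) (allFin n))
      ≡⟨ length-cartesianProduct (allFin n) (allFin n) ⟩
    length (allFin n) * length (allFin n)
      ≡⟨ cong₂ _*_ (length-allFin n) (length-allFin n) ⟩
    n * n ∎
    where open ≤-Reasoning

  faceOfDimᵇ : ℕ → Subset n → Bool
  faceOfDimᵇ i F = K F ∧ nonemptyᵇ F ∧ (dim F ≡ᵇ i)

  faceOfDimᵇ-sound : ∀ {i F} → T (faceOfDimᵇ i F) → IsFace F × dim F ≡ i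
  faceOfDimᵇ-sound {i} {F} t =
    let K[F] , rest = Equivalence.to T-∧ t
        nonempty , dim≡ = Equivalence.to T-∧ rest
    in (Equivalence.to T-≡ K[F] , nonemptyᵇ-sound nonempty) , ≡ᵇ⇒≡ (dim F) i dim≡

  weightedCount-face≤ : ∀ {I} → Unique I → ∀ F →
                        weightedCount (2 ^_) faceOfDimᵇ I [ F ] ≤ length (antipodalPairs F)
  weightedCount-face≤ {I} I! F with isFace? F
  ... | yes F-face = begin
    weightedCount (2 ^_) faceOfDimᵇ I [ F ]
      ≤⟨ weightedCount-[x]≤ (2 ^_) faceOfDimᵇ {x = F} I! (λ i t → sym (proj₂ (faceOfDimᵇ-sound t))) ⟩
    2 ^ dim F                               ≡⟨ length-subsets (dim F) ⟨
    length (subsets (dim F))                ≡⟨ length-map (antipodalPair F-face) (subsets (dim F)) ⟨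
    length (map (antipodalPair F-face) (subsets (dim F))) ∎
    where open ≤-Reasoning
  ... | no ¬face = ≤-reflexive (weightedCount-[x]≡0 (2 ^_) faceOfDimᵇ
    (All.universal (λ i t → ¬face (proj₁ (faceOfDimᵇ-sound t))) I))

  weightedSum≤n² : ∀ d → weightedSum K dim d ≤ n * n
  weightedSum≤n² d = ≤-trans
    (weightedCount≤length-concatMap (2 ^_) faceOfDimᵇ {I = upTo (suc d)} antipodalPairs
      (weightedCount-face≤ (Unique.upTo⁺ (suc d))) (subsets n))
    length-antipodalPairs≤n²

  singleton-faceOfDim0 : ∀ v → T (faceOfDimᵇ 0 ⁅ v ⁆)
  singleton-faceOfDim0 v
    rewrite vertex∈ v | ∣⁅x⁆∣≡1 v | singleton-dim≡0 K-cubical v (isDim ⁅ v ⁆ (vertex∈ v) (v , x∈⁅x⁆ v)) = _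

  n≤f₀ : n ≤ fvec K dim 0
  n≤f₀ = begin
    n                           ≡⟨ length-allFin n ⟨
    length (allFin n)           ≡⟨ length-map ⁅_⁆ (allFin n) ⟨
    length (map ⁅_⁆ (allFin n))
      ≤⟨ Unique⇒length≤ (Unique.map⁺ ⁅⁆-injective (allFin⁺ n)) singleton∈faces ⟩
    fvec K dim 0                ∎
    where
    open ≤-Reasoning
    singleton∈faces : ∀ {F} → F List.∈ map ⁅_⁆ (allFin n) → F List.∈ filter (T? ∘ faceOfDimᵇ 0) (subsets n)
    singleton∈faces F∈ with ∈-map⁻ ⁅_⁆ F∈
    ... | v , _ , refl = ∈-filter⁺ (T? ∘ faceOfDimᵇ 0) (∈-subsets ⁅ v ⁆) (singleton-faceOfDim0 v)

lemma3p1 : (n : ℕ) (K : Family n) → IsCubicalComplex K →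
    (dim : Subset n → ℕ) → IsDimFunction K dim →
    (d : ℕ) → 1 ≤ d → HasDimension K dim d →
    weightedSum K dim d ≤ fvec K dim 0 * fvec K dim 0
lemma3p1 n K K-cubical dim isDim d _ _ =
  ≤-trans (weightedSum≤n² K-cubical isDim d) (*-mono-≤ (n≤f₀ K-cubical isDim) (n≤f₀ K-cubical isDim))
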